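{- Let $G=(V,E)$ be a simple undirected connected graph with $n=|V|$ vertices. For each $i\in[0,n]$ define $\Delta(i)=\max\{\mathrm{e}(S): S\subseteq V, |S|=i\}$, $\Sigma(i)=\min\{\mathrm{e}(S): S\subseteq V, |S|=i\}$, $\mathrm{T}(i)=\max\{\mathrm{vc}(S): S\subseteq V, |S|=i\}$, $\Upsilon(i)=\min\{\mathrm{vc}(S): S\subseteq V, |S|=i\}$, where for $S\subseteq V$, $\mathrm{e}(S)$ is the number of edges $uv\in E$ with both $u\in S$ and $v\in S$, and $\mathrm{vc}(S)$ is the number of edges $uv\in E$ with $u\in S$ or $v\in S$. For each $i\in[1,n]$ define $\delta(i)=\Delta(i)-\Delta(i-1)$, $\sigma(i)=\Sigma(i)-\Sigma(i-1)$, $\tau(i)=\mathrm{T}(i)-\mathrm{T}(i-1)$, $\upsilon(i)=\Upsilon(i)-\Upsilon(i-1)$. Call a sequence $s(1),\dots,s(n)$ symmetric if $s(i)+s(n-i+1)=s(1)+s(n)$ for every $i\in[1,n]$. Then for each $s\in\{\delta,\sigma,\tau,\upsilon\}$: $G$ is regular (all vertices have the same degree) if and only if the sequence $s(1),\dots,s(n)$ is symmetric.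
   Context: $[a,b]$ denotes the set of integers $\{a,a+1,\dots,b\}$. Graphs are simple, undirected, connected and finite. -}

module Defs where

open import Data.Bool using (Bool; true; false; _∧_; _∨_; if_then_else_)
open import Data.Nat using (ℕ; zero; suc; _+_; _∸_; _⊔_; _⊓_; _≤_; _<ᵇ_)
open import Data.Integer using (ℤ; +_; _-_)
open import Data.Fin using (Fin; toℕ)
open import Data.Fin.Subset using (Subset; ∣_∣)
open import Data.Vec using (Vec; []; _∷_; lookup)
open import Data.List using (List; []; _∷_; _++_; map; filter; foldr; concatMap; allFin)
open import Data.Maybe using (Maybe; just; nothing)
open import Data.Product using (Σ; ∃; _×_; _,_)
open import Relation.Binary.PropositionalEquality using (_≡_)
open import Relation.Nullary.Decidable using (does)
open import Data.Nat using (_≟_)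

record SimpleGraph (n : ℕ) : Set where
  field
    adj    : Fin n → Fin n → Bool
    sym    : ∀ u v → adj u v ≡ adj v u
    irrefl : ∀ v → adj v v ≡ false
open SimpleGraph public

data Reach {n : ℕ} (G : SimpleGraph n) : Fin n → Fin n → Set where
  here : ∀ {u} → Reach G u u
  step : ∀ {u v w} → adj G u v ≡ true → Reach G v w → Reach G u w

Connected : ∀ {n} → SimpleGraph n → Set
Connected {n} G = ∀ (u v : Fin n) → Reach G u v

count : ∀ {A : Set} → (A → Bool) → List A → ℕ
count p []       = 0
count p (x ∷ xs) = (if p x then 1 else 0) + count p xs

degree : ∀ {n} → SimpleGraph n → Fin n → ℕ
degree {n} G v = count (adj G v) (allFin n)

Regular : ∀ {n} → SimpleGraph n → Set
Regular {n} G = ∃ λ d → ∀ (v : Fin n) → degree G v ≡ d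

-- all ordered pairs (u , v) with u < v : each edge uv counted exactly once
orderedPairs : (n : ℕ) → List (Fin n × Fin n)
orderedPairs n = concatMap (λ u → map (λ v → (u , v)) (filter (λ v → toℕ u Data.Nat.<? toℕ v) (allFin n))) (allFin n)

_∈ˢ_ : ∀ {n} → Fin n → Subset n → Bool
v ∈ˢ S = lookup S v

eS : ∀ {n} → SimpleGraph n → Subset n → ℕ
eS {n} G S = count (λ { (u , v) → adj G u v ∧ (u ∈ˢ S) ∧ (v ∈ˢ S) }) (orderedPairs n)

vcS : ∀ {n} → SimpleGraph n → Subset n → ℕ
vcS {n} G S = count (λ { (u , v) → adj G u v ∧ ((u ∈ˢ S) ∨ (v ∈ˢ S)) }) (orderedPairs n)

allSubsets : (n : ℕ) → List (Subset n)
allSubsets zero    = [] ∷ []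
allSubsets (suc n) = map (true ∷_) (allSubsets n) ++ map (false ∷_) (allSubsets n)

subsetsOfSize : (n i : ℕ) → List (Subset n)
subsetsOfSize n i = filter (λ S → ∣ S ∣ ≟ i) (allSubsets n)

maxList : List ℕ → ℕ
maxList = foldr _⊔_ 0

-- minimum of a list; value on the empty list is irrelevant (never used for i ≤ n)
minList : List ℕ → ℕ
minList []       = 0
minList (x ∷ []) = x
minList (x ∷ y ∷ ys) = x ⊓ minList (y ∷ ys)

Δ Σ' T Υ : ∀ {n} → SimpleGraph n → ℕ → ℕ
Δ  {n} G i = maxList (map (eS G)  (subsetsOfSize n i))
Σ' {n} G i = minList (map (eS G)  (subsetsOfSize n i))
T  {n} G i = maxList (map (vcS G) (subsetsOfSize n i))
Υ  {n} G i = minList (map (vcS G) (subsetsOfSize n i))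

diff : (ℕ → ℕ) → ℕ → ℤ
diff F i = + F i - + F (i ∸ 1)

δ σ τ υ : ∀ {n} → SimpleGraph n → ℕ → ℤ
δ G = diff (Δ G)
σ G = diff (Σ' G)
τ G = diff (T G)
υ G = diff (Υ G)

Symmetric : ℕ → (ℕ → ℤ) → Set
Symmetric n s = ∀ i → 1 ≤ i → i ≤ n → s i Data.Integer.+ s (suc n ∸ i) ≡ s 1 Data.Integer.+ s n

-- For S ⊆ V, counting the ends of the edges at S gives Σ_{v ∈ S} deg v = e(S) + vc(S),
-- and every edge either touches S or lies in V ∖ S, so vc(S) + e(V ∖ S) = m.
-- Complementation therefore exchanges size-i extremisers of vc with size-(n-i)
-- extremisers of e: T(i) + Σ(n-i) = Υ(i) + Δ(n-i) = m, so τ and υ are σ and δ read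
-- backwards and are symmetric exactly when those are.
-- If G is d-regular then e(S) + m = d|S| + e(V ∖ S), hence Δ(i) + m = d i + Δ(n-i) and
-- δ(i) + δ(n+1-i) = d for all i; the same holds for Σ and σ.
-- Conversely, summing the symmetry relation over i telescopes to 2(Δ(n) - Δ(0)) = n (δ(1) + δ(n)).
-- As Δ(0) = Δ(1) = 0, Δ(n) = m and δ(n) = m - Δ(n-1) = Υ(1) is the minimum degree, this
-- says 2m = n · (minimum degree), which forces all degrees to be equal; for σ the
-- maximum degree T(1) plays the same role.
module Submission where

open import Defs hiding (sym)
open import Data.Nat as ℕ using (ℕ; zero; suc; _∸_; _≤_; z≤n; s≤s)
open import Data.Product using (_×_; _,_; ∃; proj₂)
open import Function.Bundles using (_⇔_; mk⇔)
open import Relation.Binary.PropositionalEquality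

-- Difference sequences

module _ where
  open import Data.Integer using (ℤ; +_; 0ℤ; _+_; _-_; _*_)
  open import Data.Integer.Properties using (+-comm; +-inverseʳ; +-injective; pos-+; pos-*)
  open import Data.Integer.Tactic.RingSolver using (solve-∀)
  import Data.Nat.Properties as ℕ

  Reflected : ℕ → (ℕ → ℤ) → (ℕ → ℤ) → Set
  Reflected n s t = ∀ i → 1 ≤ i → i ≤ n → s i ≡ t (suc n ∸ i)

  private
    reflect-range : ∀ {n i} → 1 ≤ i → i ≤ n → 1 ≤ suc n ∸ i × suc n ∸ i ≤ n
    reflect-range {n} {suc j} _ j<n = ℕ.m<n⇒0<n∸m j<n , ℕ.m∸n≤m n j

  Reflected-sym : ∀ {n s t} → Reflected n s t → Reflected n t s
  Reflected-sym {n} {s} {t} s≡t i 1≤i i≤n =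
    let 1≤i' , i'≤n = reflect-range 1≤i i≤n in
    sym (trans (s≡t (suc n ∸ i) 1≤i' i'≤n) (cong t (ℕ.m∸[m∸n]≡n (ℕ.m≤n⇒m≤1+n i≤n))))

  Symmetric-reflected : ∀ {n s t} → Reflected n s t → Symmetric n t → Symmetric n s
  Symmetric-reflected {n} {s} {t} s≡t t-sym i 1≤i i≤n = begin
    s i + s (suc n ∸ i)    ≡⟨ cong₂ _+_ (s≡t i 1≤i i≤n) (sym (Reflected-sym {s = s} {t} s≡t i 1≤i i≤n)) ⟩
    t (suc n ∸ i) + t i    ≡⟨ +-comm (t (suc n ∸ i)) (t i) ⟩
    t i + t (suc n ∸ i)    ≡⟨ t-sym i 1≤i i≤n ⟩
    t 1 + t n              ≡⟨ +-comm (t 1) (t n) ⟩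
    t n + t 1              ≡⟨ cong₂ _+_ (sym (s≡t 1 ℕ.≤-refl 1≤n))
                                        (Reflected-sym {s = s} {t} s≡t 1 ℕ.≤-refl 1≤n) ⟩
    s 1 + s n              ∎
    where
    open ≡-Reasoning
    1≤n = ℕ.≤-trans 1≤i i≤n

  Reflected⇒Symmetric⇔ : ∀ {n s t} → Reflected n s t → Symmetric n t ⇔ Symmetric n s
  Reflected⇒Symmetric⇔ {s = s} {t} s≡t =
    mk⇔ (Symmetric-reflected {s = s} {t} s≡t) (Symmetric-reflected {s = t} {s} (Reflected-sym {s = s} s≡t))

  Symmetric-of-constant-pair-sums : ∀ {n s c} →
    (∀ i → 1 ≤ i → i ≤ n → s i + s (suc n ∸ i) ≡ c) → Symmetric n s
  Symmetric-of-constant-pair-sums pair≡c i 1≤i i≤n =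
    trans (pair≡c i 1≤i i≤n) (sym (pair≡c 1 ℕ.≤-refl (ℕ.≤-trans 1≤i i≤n)))

  private
    pos-+-≡ : ∀ a b c d → a ℕ.+ b ≡ c ℕ.+ d → + a + + b ≡ + c + + d
    pos-+-≡ a b c d eq = trans (sym (pos-+ a b)) (trans (cong +_ eq) (pos-+ c d))

    diff-reflected-at : ∀ F n j → diff F (suc n ∸ suc j) ≡ + F (n ∸ j) - + F (n ∸ suc j)
    diff-reflected-at F n j = cong (λ k → + F (n ∸ j) - + F k) (trans (ℕ.∸-+-assoc n j 1) (cong (n ∸_) (ℕ.+-comm j 1)))

  diff-pair-sums : ∀ {F n a d} → (∀ i → i ≤ n → F i ℕ.+ a ≡ d ℕ.* i ℕ.+ F (n ∸ i)) →
    ∀ i → 1 ≤ i → i ≤ n → diff F i + diff F (suc n ∸ i) ≡ + d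
  diff-pair-sums {F} {n} {a} {d} rel (suc j) _ j<n = begin
    diff F (suc j) + diff F (suc n ∸ suc j)
      ≡⟨ cong (λ z → diff F (suc j) + z) (diff-reflected-at F n j) ⟩
    (X₁ - X₀) + (Y₀ - Y₁)
      ≡⟨ regroup X₁ X₀ Y₁ Y₀ (+ a) ⟩
    ((X₁ + + a) - Y₁) - ((X₀ + + a) - Y₀)
      ≡⟨ cong₂ (λ p q → (p - Y₁) - (q - Y₀)) h₁ h₀ ⟩
    ((+ (d ℕ.* suc j) + Y₁) - Y₁) - ((+ (d ℕ.* j) + Y₀) - Y₀)
      ≡⟨ cancel (+ (d ℕ.* suc j)) Y₁ (+ (d ℕ.* j)) Y₀ ⟩
    + (d ℕ.* suc j) - + (d ℕ.* j)
      ≡⟨ cong (_- + (d ℕ.* j)) (trans (cong +_ (ℕ.*-suc d j)) (pos-+ d (d ℕ.* j))) ⟩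
    (+ d + + (d ℕ.* j)) - + (d ℕ.* j)
      ≡⟨ add-sub (+ d) (+ (d ℕ.* j)) ⟩
    + d ∎
    where
    open ≡-Reasoning
    X₁ X₀ Y₁ Y₀ : ℤ
    X₁ = + F (suc j)
    X₀ = + F j
    Y₁ = + F (n ∸ suc j)
    Y₀ = + F (n ∸ j)
    h₁ : X₁ + + a ≡ + (d ℕ.* suc j) + Y₁
    h₁ = pos-+-≡ (F (suc j)) a (d ℕ.* suc j) (F (n ∸ suc j)) (rel (suc j) j<n)
    h₀ : X₀ + + a ≡ + (d ℕ.* j) + Y₀
    h₀ = pos-+-≡ (F j) a (d ℕ.* j) (F (n ∸ j)) (rel j (ℕ.<⇒≤ j<n))
    regroup : ∀ x₁ x₀ y₁ y₀ a → (x₁ - x₀) + (y₀ - y₁) ≡ ((x₁ + a) - y₁) - ((x₀ + a) - y₀)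
    regroup = solve-∀
    cancel : ∀ b₁ y₁ b₀ y₀ → ((b₁ + y₁) - y₁) - ((b₀ + y₀) - y₀) ≡ b₁ - b₀
    cancel = solve-∀
    add-sub : ∀ x y → (x + y) - y ≡ x
    add-sub = solve-∀

  diff-reflected : ∀ {F G n m} → (∀ i → i ≤ n → F i ℕ.+ G (n ∸ i) ≡ m) → Reflected n (diff F) (diff G)
  diff-reflected {F} {G} {n} {m} rel (suc j) _ j<n = begin
    X₁ - X₀                            ≡⟨ regroup X₁ X₀ Y₁ Y₀ ⟩
    ((X₁ + Y₁) - (X₀ + Y₀)) + (Y₀ - Y₁) ≡⟨ cong₂ (λ p q → (p - q) + (Y₀ - Y₁)) h₁ h₀ ⟩
    (+ m - + m) + (Y₀ - Y₁)            ≡⟨ cancel (+ m) (Y₀ - Y₁) ⟩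
    Y₀ - Y₁                            ≡⟨ diff-reflected-at G n j ⟨
    diff G (suc n ∸ suc j)             ∎
    where
    open ≡-Reasoning
    X₁ X₀ Y₁ Y₀ : ℤ
    X₁ = + F (suc j)
    X₀ = + F j
    Y₁ = + G (n ∸ suc j)
    Y₀ = + G (n ∸ j)
    h₁ : X₁ + Y₁ ≡ + m
    h₁ = trans (sym (pos-+ (F (suc j)) _)) (cong +_ (rel (suc j) j<n))
    h₀ : X₀ + Y₀ ≡ + m
    h₀ = trans (sym (pos-+ (F j) _)) (cong +_ (rel j (ℕ.<⇒≤ j<n)))
    regroup : ∀ x₁ x₀ y₁ y₀ → x₁ - x₀ ≡ ((x₁ + y₁) - (x₀ + y₀)) + (y₀ - y₁)
    regroup = solve-∀
    cancel : ∀ x y → (x - x) + y ≡ y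
    cancel = solve-∀

  partialSum : (ℕ → ℤ) → ℕ → ℤ
  partialSum s zero    = 0ℤ
  partialSum s (suc k) = partialSum s k + s (suc k)

  private
    telescope : ∀ a b c → (b - a) + (c - b) ≡ c - a
    telescope = solve-∀

  partialSum-diff : ∀ F k → partialSum (diff F) k ≡ + F k - + F 0
  partialSum-diff F zero    = sym (+-inverseʳ (+ F 0))
  partialSum-diff F (suc k) = trans (cong (_+ diff F (suc k)) (partialSum-diff F k)) (telescope (+ F 0) (+ F k) (+ F (suc k)))

  partialSum-diff-reflected : ∀ F n k → partialSum (λ i → diff F (suc n ∸ i)) k ≡ + F n - + F (n ∸ k)
  partialSum-diff-reflected F n zero    = sym (+-inverseʳ (+ F n))
  partialSum-diff-reflected F n (suc k) =
    trans (cong₂ _+_ (partialSum-diff-reflected F n k) (diff-reflected-at F n k))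
          (trans (+-comm (+ F n - + F (n ∸ k)) _) (telescope (+ F (n ∸ suc k)) (+ F (n ∸ k)) (+ F n)))

  partialSum-+ : ∀ s t k → partialSum (λ i → s i + t i) k ≡ partialSum s k + partialSum t k
  partialSum-+ s t zero    = refl
  partialSum-+ s t (suc k) = trans (cong (_+ (s (suc k) + t (suc k))) (partialSum-+ s t k))
                                   (+-interchange (partialSum s k) _ _ _)
    where
    +-interchange : ∀ a b c d → (a + b) + (c + d) ≡ (a + c) + (b + d)
    +-interchange = solve-∀

  partialSum-const : ∀ {s c} k → (∀ i → 1 ≤ i → i ≤ k → s i ≡ c) → partialSum s k ≡ + k * c
  partialSum-const zero    _    = refl
  partialSum-const {s} {c} (suc k) s≡c =
    trans (cong₂ _+_ (partialSum-const k (λ i 1≤i i≤k → s≡c i 1≤i (ℕ.m≤n⇒m≤1+n i≤k)))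
                     (s≡c (suc k) (s≤s z≤n) ℕ.≤-refl))
          (*-suc-distrib (+ k) c)
    where
    *-suc-distrib : ∀ k c → k * c + c ≡ (+ 1 + k) * c
    *-suc-distrib = solve-∀

  Symmetric-diff⇒twice-increment : ∀ {F n} → Symmetric n (diff F) →
    (+ F n - + F 0) + (+ F n - + F 0) ≡ + n * (diff F 1 + diff F n)
  Symmetric-diff⇒twice-increment {F} {n} sym-diff = begin
    (+ F n - + F 0) + (+ F n - + F 0)
      ≡⟨ cong₂ _+_ (partialSum-diff F n)
                   (trans (partialSum-diff-reflected F n n) (cong (λ k → + F n - + F k) (ℕ.n∸n≡0 n))) ⟨
    partialSum (diff F) n + partialSum (λ i → diff F (suc n ∸ i)) n
      ≡⟨ partialSum-+ (diff F) (λ i → diff F (suc n ∸ i)) n ⟨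
    partialSum (λ i → diff F i + diff F (suc n ∸ i)) n
      ≡⟨ partialSum-const n sym-diff ⟩
    + n * (diff F 1 + diff F n) ∎
    where open ≡-Reasoning

  Symmetric-diff⇒F[n]+F[n]≡n*c : ∀ {F n c} → Symmetric n (diff F) →
    F 0 ≡ 0 → F 1 ≡ 0 → c ℕ.+ F (n ∸ 1) ≡ F n → F n ℕ.+ F n ≡ n ℕ.* c
  Symmetric-diff⇒F[n]+F[n]≡n*c {F} {n} {c} sym-diff F0≡0 F1≡0 c+F[n-1]≡F[n] = +-injective (begin
    + (F n ℕ.+ F n)                             ≡⟨ pos-+ (F n) (F n) ⟩
    + F n + + F n                               ≡⟨ sub-0 (+ F n) ⟩
    (+ F n - 0ℤ) + (+ F n - 0ℤ)                 ≡⟨ cong (λ z → (+ F n - + z) + (+ F n - + z)) F0≡0 ⟨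
    (+ F n - + F 0) + (+ F n - + F 0)            ≡⟨ Symmetric-diff⇒twice-increment {F} sym-diff ⟩
    + n * ((+ F 1 - + F 0) + (+ F n - + F (n ∸ 1))) ≡⟨ cong (λ z → + n * z) (cong₂ _+_ first last) ⟩
    + n * + c                                   ≡⟨ pos-* n c ⟨
    + (n ℕ.* c)                                 ∎)
    where
    open ≡-Reasoning
    sub-0 : ∀ x → x + x ≡ (x - 0ℤ) + (x - 0ℤ)
    sub-0 = solve-∀
    first : + F 1 - + F 0 ≡ 0ℤ
    first = cong₂ (λ a b → + a - + b) F1≡0 F0≡0
    last : + F n - + F (n ∸ 1) ≡ + c
    last = begin
      + F n - + F (n ∸ 1)             ≡⟨ cong (λ z → + z - + F (n ∸ 1)) c+F[n-1]≡F[n] ⟨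
      + (c ℕ.+ F (n ∸ 1)) - + F (n ∸ 1) ≡⟨ cong (_- + F (n ∸ 1)) (pos-+ c _) ⟩
      (+ c + + F (n ∸ 1)) - + F (n ∸ 1) ≡⟨ add-sub (+ c) (+ F (n ∸ 1)) ⟩
      + c                             ∎
      where
      add-sub : ∀ x y → (x + y) - y ≡ x
      add-sub = solve-∀

-- ℕ's arithmetic is opened only from here on, so that it does not clash with ℤ's above.
open import Data.Bool using (Bool; true; false; _∧_; _∨_; not; if_then_else_)
open import Data.Bool.Properties using (not-involutive; ∧-identityʳ; ∧-zeroʳ)
open import Data.Nat using (_+_; _*_; s≤s⁻¹)
open import Data.Nat.Properties
open import Data.Fin as Fin using (Fin; toℕ)
open import Data.Fin.Properties using (toℕ-injective)
open import Data.Fin.Subset using (Subset; ∣_∣; ∁; ⁅_⁆; ⊤; ⊥)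
open import Data.Fin.Subset.Properties using (∣⊥∣≡0; ∣∁p∣≡n∸∣p∣; ∣⁅x⁆∣≡1; ∣p∣≡n⇒p≡⊤)
open import Data.Vec using (_∷_; [])
open import Data.Vec.Properties using (lookup-map; lookup-replicate)
open import Data.List using (List; []; _∷_; _++_; map; filter; concatMap; tabulate; allFin)
open import Data.List.Membership.Propositional using (_∈_)
open import Data.List.Membership.Propositional.Properties
  using (∈-map⁺; ∈-map⁻; ∈-++⁺ˡ; ∈-++⁺ʳ; ∈-filter⁺; ∈-filter⁻)
open import Data.List.Relation.Unary.Any using (here; there)
open import Data.Sum using (inj₁; inj₂)
open import Function using (_⟨_⟩_)
open import Function.Properties.Equivalence using () renaming (trans to ⇔-trans)
open import Relation.Binary.Definitions using (tri<; tri≈; tri>)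
open import Relation.Nullary.Decidable using (Dec; does; dec-true; dec-false)
open import Relation.Nullary.Negation using (contradiction)
open import Algebra.Properties.CommutativeSemigroup +-commutativeSemigroup
  using () renaming (interchange to +-interchange)
open import Algebra.Properties.Semiring.Sum +-*-semiring
  using (sum; sum-syntax; sum-cong-≗; ∑-distrib-+; ∑-comm; *-distribˡ-sum; *-distribʳ-sum; sum-replicate-zero)

-- Counting and finite sums

𝟙 : Bool → ℕ
𝟙 b = if b then 1 else 0

count-++ : ∀ {A : Set} (p : A → Bool) xs ys → count p (xs ++ ys) ≡ count p xs + count p ys
count-++ p []       ys = refl
count-++ p (x ∷ xs) ys = trans (cong (𝟙 (p x) +_) (count-++ p xs ys)) (sym (+-assoc (𝟙 (p x)) _ _))

count-map : ∀ {A B : Set} (p : B → Bool) (f : A → B) xs → count p (map f xs) ≡ count (λ x → p (f x)) xs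
count-map p f []       = refl
count-map p f (x ∷ xs) = cong (𝟙 (p (f x)) +_) (count-map p f xs)

count-filter : ∀ {A : Set} (p : A → Bool) {P : A → Set} (P? : ∀ x → Dec (P x)) xs →
  count p (filter P? xs) ≡ count (λ x → does (P? x) ∧ p x) xs
count-filter p P? []       = refl
count-filter p P? (x ∷ xs) with does (P? x)
... | true  = cong (𝟙 (p x) +_) (count-filter p P? xs)
... | false = count-filter p P? xs

count-tabulate : ∀ {A : Set} {n} (p : A → Bool) (f : Fin n → A) → count p (tabulate f) ≡ ∑[ i < n ] 𝟙 (p (f i))
count-tabulate {n = zero}  p f = refl
count-tabulate {n = suc n} p f = cong (𝟙 (p (f Fin.zero)) +_) (count-tabulate p (λ i → f (Fin.suc i)))

count-concatMap-tabulate : ∀ {A B : Set} {n} (p : B → Bool) (H : A → List B) (f : Fin n → A) →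
  count p (concatMap H (tabulate f)) ≡ ∑[ i < n ] count p (H (f i))
count-concatMap-tabulate {n = zero}  p H f = refl
count-concatMap-tabulate {n = suc n} p H f =
  trans (count-++ p (H (f Fin.zero)) _)
        (cong (count p (H (f Fin.zero)) +_) (count-concatMap-tabulate p H (λ i → f (Fin.suc i))))

count-cong : ∀ {A : Set} {p q : A → Bool} → (∀ x → p x ≡ q x) → ∀ xs → count p xs ≡ count q xs
count-cong p≗q []       = refl
count-cong p≗q (x ∷ xs) = cong₂ _+_ (cong 𝟙 (p≗q x)) (count-cong p≗q xs)

count-≡0 : ∀ {A : Set} {p : A → Bool} → (∀ x → p x ≡ false) → ∀ xs → count p xs ≡ 0
count-≡0 p≡false []       = refl
count-≡0 p≡false (x ∷ xs) rewrite p≡false x = count-≡0 p≡false xs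

count-+ : ∀ {A : Set} {p q r : A → Bool} → (∀ x → 𝟙 (p x) + 𝟙 (q x) ≡ 𝟙 (r x)) →
  ∀ xs → count p xs + count q xs ≡ count r xs
count-+ pq≡r []       = refl
count-+ {p = p} {q} pq≡r (x ∷ xs) =
  trans (+-interchange (𝟙 (p x)) _ (𝟙 (q x)) _) (cong₂ _+_ (pq≡r x) (count-+ pq≡r xs))

∑-const : ∀ n c → ∑[ i < n ] c ≡ n * c
∑-const zero    c = refl
∑-const (suc n) c = cong (c +_) (∑-const n c)

∑-mono-≤ : ∀ {n} {f g : Fin n → ℕ} → (∀ i → f i ≤ g i) → ∑[ i < n ] f i ≤ ∑[ i < n ] g i
∑-mono-≤ {zero}  f≤g = z≤n
∑-mono-≤ {suc n} f≤g = +-mono-≤ (f≤g Fin.zero) (∑-mono-≤ (λ i → f≤g (Fin.suc i)))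

+-mono-≤-≡⇒≡ : ∀ {a b c d} → a ≤ c → b ≤ d → a + b ≡ c + d → a ≡ c × b ≡ d
+-mono-≤-≡⇒≡ {a} {b} {c} {d} a≤c b≤d a+b≡c+d =
  a≡c , +-cancelˡ-≡ c b d (subst (λ x → x + b ≡ c + d) a≡c a+b≡c+d)
  where
  a≡c : a ≡ c
  a≡c = ≤-antisym a≤c (+-cancelʳ-≤ b c a (≤-trans (+-monoʳ-≤ c b≤d) (≤-reflexive (sym a+b≡c+d))))

∑-mono-≤-≡⇒≡ : ∀ {n} {f g : Fin n → ℕ} → (∀ i → f i ≤ g i) →
  ∑[ i < n ] f i ≡ ∑[ i < n ] g i → ∀ i → f i ≡ g i
∑-mono-≤-≡⇒≡ {suc n} f≤g ∑f≡∑g i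
  with +-mono-≤-≡⇒≡ (f≤g Fin.zero) (∑-mono-≤ (λ j → f≤g (Fin.suc j))) ∑f≡∑g
∑-mono-≤-≡⇒≡ {suc n} f≤g ∑f≡∑g Fin.zero    | head≡ , _     = head≡
∑-mono-≤-≡⇒≡ {suc n} f≤g ∑f≡∑g (Fin.suc i) | _     , tail≡ =
  ∑-mono-≤-≡⇒≡ (λ j → f≤g (Fin.suc j)) tail≡ i

_<ᶠ_ : ∀ {n} → Fin n → Fin n → Bool
u <ᶠ v = does (toℕ u ℕ.<? toℕ v)

count-orderedPairs : ∀ {n} (P : Fin n × Fin n → Bool) →
  count P (orderedPairs n) ≡ ∑[ u < n ] ∑[ v < n ] 𝟙 ((u <ᶠ v) ∧ P (u , v))
count-orderedPairs {n} P = begin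
  count P (orderedPairs n)
    ≡⟨ count-concatMap-tabulate P row (λ u → u) ⟩
  ∑[ u < n ] count P (row u)
    ≡⟨ sum-cong-≗ (λ u → count-map P (u ,_) (filter (λ v → toℕ u ℕ.<? toℕ v) (allFin n))) ⟩
  ∑[ u < n ] count (λ v → P (u , v)) (filter (λ v → toℕ u ℕ.<? toℕ v) (allFin n))
    ≡⟨ sum-cong-≗ (λ u → count-filter (λ v → P (u , v)) (λ v → toℕ u ℕ.<? toℕ v) (allFin n)) ⟩
  ∑[ u < n ] count (λ v → (u <ᶠ v) ∧ P (u , v)) (allFin n)
    ≡⟨ sum-cong-≗ (λ u → count-tabulate (λ v → (u <ᶠ v) ∧ P (u , v)) (λ v → v)) ⟩
  ∑[ u < n ] ∑[ v < n ] 𝟙 ((u <ᶠ v) ∧ P (u , v)) ∎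
  where
  open ≡-Reasoning
  row : Fin n → List (Fin n × Fin n)
  row u = map (u ,_) (filter (λ v → toℕ u ℕ.<? toℕ v) (allFin n))

<ᶠ-split : ∀ {n} (u v : Fin n) (x : ℕ) → (u ≡ v → x ≡ 0) → x ≡ 𝟙 (u <ᶠ v) * x + 𝟙 (v <ᶠ u) * x
<ᶠ-split u v x diag with <-cmp (toℕ u) (toℕ v)
... | tri< u<v _ _
  rewrite dec-true (toℕ u ℕ.<? toℕ v) u<v | dec-false (toℕ v ℕ.<? toℕ u) (<-asym u<v) =
  sym (trans (+-identityʳ _) (+-identityʳ x))
... | tri> _ _ v<u
  rewrite dec-false (toℕ u ℕ.<? toℕ v) (<-asym v<u) | dec-true (toℕ v ℕ.<? toℕ u) v<u =
  sym (+-identityʳ x)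
... | tri≈ _ u≡v _ rewrite diag (toℕ-injective u≡v) =
  sym (cong₂ _+_ (*-zeroʳ (𝟙 (u <ᶠ v))) (*-zeroʳ (𝟙 (v <ᶠ u))))

∑∑-offDiagonal : ∀ {n} (h : Fin n → Fin n → ℕ) → (∀ u → h u u ≡ 0) →
  ∑[ u < n ] ∑[ v < n ] h u v ≡ ∑[ u < n ] ∑[ v < n ] (𝟙 (u <ᶠ v) * (h u v + h v u))
∑∑-offDiagonal {n} h h-diag = begin
  ∑[ u < n ] ∑[ v < n ] h u v
    ≡⟨ sum-cong-≗ (λ u → sum-cong-≗ (split u)) ⟩
  ∑[ u < n ] ∑[ v < n ] (below u v + above u v)
    ≡⟨ sum-cong-≗ (λ u → ∑-distrib-+ (below u) (above u)) ⟩
  ∑[ u < n ] (∑[ v < n ] below u v + ∑[ v < n ] above u v)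
    ≡⟨ ∑-distrib-+ (λ u → ∑[ v < n ] below u v) (λ u → ∑[ v < n ] above u v) ⟩
  ∑[ u < n ] ∑[ v < n ] below u v + ∑[ u < n ] ∑[ v < n ] above u v
    ≡⟨ cong (∑[ u < n ] ∑[ v < n ] below u v +_) (∑-comm above) ⟩
  ∑[ u < n ] ∑[ v < n ] below u v + ∑[ u < n ] ∑[ v < n ] above v u
    ≡⟨ sym (∑-distrib-+ (λ u → ∑[ v < n ] below u v) (λ u → ∑[ v < n ] above v u)) ⟩
  ∑[ u < n ] (∑[ v < n ] below u v + ∑[ v < n ] above v u)
    ≡⟨ sum-cong-≗ (λ u → sym (∑-distrib-+ (below u) (λ v → above v u))) ⟩
  ∑[ u < n ] ∑[ v < n ] (below u v + above v u)
    ≡⟨ sum-cong-≗ (λ u → sum-cong-≗ (λ v → sym (*-distribˡ-+ (𝟙 (u <ᶠ v)) (h u v) (h v u)))) ⟩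
  ∑[ u < n ] ∑[ v < n ] (𝟙 (u <ᶠ v) * (h u v + h v u)) ∎
  where
  open ≡-Reasoning
  below above : Fin n → Fin n → ℕ
  below u v = 𝟙 (u <ᶠ v) * h u v
  above u v = 𝟙 (v <ᶠ u) * h u v
  split : ∀ u v → h u v ≡ below u v + above u v
  split u v = <ᶠ-split u v (h u v) (λ { refl → h-diag u })

-- Subsets and extremal values over subsets of a given size

∑-indicator : ∀ {n} (S : Subset n) → ∑[ u < n ] 𝟙 (u ∈ˢ S) ≡ ∣ S ∣
∑-indicator []          = refl
∑-indicator (true ∷ S)  = cong suc (∑-indicator S)
∑-indicator (false ∷ S) = ∑-indicator S

∑-⁅⁆ : ∀ {n} (v : Fin n) (f : Fin n → ℕ) → ∑[ u < n ] (𝟙 (u ∈ˢ ⁅ v ⁆) * f u) ≡ f v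
∑-⁅⁆ {suc n} Fin.zero f = begin
  1 * f Fin.zero + ∑[ u < n ] (𝟙 (u ∈ˢ ⊥) * f (Fin.suc u))
    ≡⟨ cong₂ _+_ (*-identityˡ _)
                 (sum-cong-≗ (λ u → cong (λ b → 𝟙 b * f (Fin.suc u)) (lookup-replicate u false))) ⟩
  f Fin.zero + ∑[ u < n ] 0
    ≡⟨ cong (f Fin.zero +_) (sum-replicate-zero n) ⟩
  f Fin.zero + 0
    ≡⟨ +-identityʳ _ ⟩
  f Fin.zero ∎
  where open ≡-Reasoning
∑-⁅⁆ {suc n} (Fin.suc v) f = ∑-⁅⁆ v (λ u → f (Fin.suc u))

∁-involutive : ∀ {n} (S : Subset n) → ∁ (∁ S) ≡ S
∁-involutive []      = refl
∁-involutive (b ∷ S) = cong₂ _∷_ (not-involutive b) (∁-involutive S)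

∈ˢ⇒1≤∣∣ : ∀ {n} (S : Subset n) {u} → u ∈ˢ S ≡ true → 1 ≤ ∣ S ∣
∈ˢ⇒1≤∣∣ (true ∷ S)  {Fin.zero}  _  = s≤s z≤n
∈ˢ⇒1≤∣∣ (true ∷ S)  {Fin.suc u} u∈ = ≤-trans (∈ˢ⇒1≤∣∣ S u∈) (n≤1+n _)
∈ˢ⇒1≤∣∣ (false ∷ S) {Fin.suc u} u∈ = ∈ˢ⇒1≤∣∣ S u∈

∣∣≤1⇒∈ˢ-unique : ∀ {n} (S : Subset n) → ∣ S ∣ ≤ 1 →
  ∀ {u v} → u ∈ˢ S ≡ true → v ∈ˢ S ≡ true → u ≡ v
∣∣≤1⇒∈ˢ-unique (true ∷ S)  _   {Fin.zero}  {Fin.zero}  _  _  = refl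
∣∣≤1⇒∈ˢ-unique (true ∷ S)  ≤1  {Fin.zero}  {Fin.suc v} _  v∈ =
  contradiction (≤-trans (∈ˢ⇒1≤∣∣ S v∈) (s≤s⁻¹ ≤1)) λ ()
∣∣≤1⇒∈ˢ-unique (true ∷ S)  ≤1  {Fin.suc u} {_}         u∈ _  =
  contradiction (≤-trans (∈ˢ⇒1≤∣∣ S u∈) (s≤s⁻¹ ≤1)) λ ()
∣∣≤1⇒∈ˢ-unique (false ∷ S) ≤1  {Fin.suc u} {Fin.suc v} u∈ v∈ =
  cong Fin.suc (∣∣≤1⇒∈ˢ-unique S ≤1 u∈ v∈)

∈-allSubsets : ∀ {n} (S : Subset n) → S ∈ allSubsets n
∈-allSubsets []                = here refl
∈-allSubsets {suc n} (true ∷ S)  = ∈-++⁺ˡ (∈-map⁺ (true ∷_) (∈-allSubsets S))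
∈-allSubsets {suc n} (false ∷ S) = ∈-++⁺ʳ (map (true ∷_) (allSubsets n)) (∈-map⁺ (false ∷_) (∈-allSubsets S))

∈-subsetsOfSize⁺ : ∀ {n i} (S : Subset n) → ∣ S ∣ ≡ i → S ∈ subsetsOfSize n i
∈-subsetsOfSize⁺ {i = i} S ∣S∣≡i = ∈-filter⁺ (λ S → ∣ S ∣ ℕ.≟ i) (∈-allSubsets S) ∣S∣≡i

∈-subsetsOfSize⁻ : ∀ {n i} {S : Subset n} → S ∈ subsetsOfSize n i → ∣ S ∣ ≡ i
∈-subsetsOfSize⁻ {n} {i} S∈ = proj₂ (∈-filter⁻ (λ S → ∣ S ∣ ℕ.≟ i) {xs = allSubsets n} S∈)

subset-of-size : ∀ {n i} → i ≤ n → ∃ λ (S : Subset n) → ∣ S ∣ ≡ i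
subset-of-size {n}     {zero}  _         = ⊥ , ∣⊥∣≡0 n
subset-of-size {suc n} {suc i} (s≤s i≤n) with subset-of-size i≤n
... | S , ∣S∣≡i = true ∷ S , cong suc ∣S∣≡i

maxList-upper : ∀ {x xs} → x ∈ xs → x ≤ maxList xs
maxList-upper {xs = y ∷ ys} (here refl) = m≤m⊔n y _
maxList-upper {xs = y ∷ ys} (there x∈) = ≤-trans (maxList-upper x∈) (m≤n⊔m y _)

maxList-∈ : ∀ {x xs} → x ∈ xs → maxList xs ∈ xs
maxList-∈ {xs = y ∷ ys} _ = max-∈ y ys
  where
  max-∈ : ∀ y ys → maxList (y ∷ ys) ∈ y ∷ ys
  max-∈ y []       = here (⊔-identityʳ y)
  max-∈ y (z ∷ zs) with ⊔-sel y (maxList (z ∷ zs))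
  ... | inj₁ ⊔≡y   = here ⊔≡y
  ... | inj₂ ⊔≡max = subst (_∈ y ∷ z ∷ zs) (sym ⊔≡max) (there (max-∈ z zs))

minList-lower : ∀ {x xs} → x ∈ xs → minList xs ≤ x
minList-lower {xs = y ∷ []}     (here refl) = ≤-refl
minList-lower {xs = y ∷ z ∷ zs} (here refl) = m⊓n≤m y _
minList-lower {xs = y ∷ z ∷ zs} (there x∈) = ≤-trans (m⊓n≤n y _) (minList-lower x∈)

minList-∈ : ∀ {x xs} → x ∈ xs → minList xs ∈ xs
minList-∈ {xs = y ∷ ys} _ = min-∈ y ys
  where
  min-∈ : ∀ y ys → minList (y ∷ ys) ∈ y ∷ ys
  min-∈ y []       = here refl
  min-∈ y (z ∷ zs) with ⊓-sel y (minList (z ∷ zs))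
  ... | inj₁ ⊓≡y   = here ⊓≡y
  ... | inj₂ ⊓≡min = subst (_∈ y ∷ z ∷ zs) (sym ⊓≡min) (there (min-∈ z zs))

maxOver minOver : ∀ {n} → (Subset n → ℕ) → ℕ → ℕ
maxOver {n} f i = maxList (map f (subsetsOfSize n i))
minOver {n} f i = minList (map f (subsetsOfSize n i))

module _ {n : ℕ} (f : Subset n → ℕ) where

  private
    value-of-size : ∀ {i} S → ∣ S ∣ ≡ i → f S ∈ map f (subsetsOfSize n i)
    value-of-size S ∣S∣≡i = ∈-map⁺ f (∈-subsetsOfSize⁺ S ∣S∣≡i)

    attained : ∀ {i} {x} → x ∈ map f (subsetsOfSize n i) → ∃ λ S → ∣ S ∣ ≡ i × x ≡ f S
    attained x∈ with ∈-map⁻ f x∈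
    ... | S , S∈ , x≡fS = S , ∈-subsetsOfSize⁻ S∈ , x≡fS

  ≤-maxOver : ∀ {i} S → ∣ S ∣ ≡ i → f S ≤ maxOver f i
  ≤-maxOver S ∣S∣≡i = maxList-upper (value-of-size S ∣S∣≡i)

  minOver-≤ : ∀ {i} S → ∣ S ∣ ≡ i → minOver f i ≤ f S
  minOver-≤ S ∣S∣≡i = minList-lower (value-of-size S ∣S∣≡i)

  maxOver-attained : ∀ {i} → i ≤ n → ∃ λ S → ∣ S ∣ ≡ i × maxOver f i ≡ f S
  maxOver-attained i≤n = let S , ∣S∣≡i = subset-of-size i≤n in attained (maxList-∈ (value-of-size S ∣S∣≡i))

  minOver-attained : ∀ {i} → i ≤ n → ∃ λ S → ∣ S ∣ ≡ i × minOver f i ≡ f S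
  minOver-attained i≤n = let S , ∣S∣≡i = subset-of-size i≤n in attained (minList-∈ (value-of-size S ∣S∣≡i))

module _ {n i : ℕ} (i≤n : i ≤ n) where

  ∣∁∣≡n∸i : (S : Subset n) → ∣ S ∣ ≡ i → ∣ ∁ S ∣ ≡ n ∸ i
  ∣∁∣≡n∸i S ∣S∣≡i = trans (∣∁p∣≡n∸∣p∣ S) (cong (n ∸_) ∣S∣≡i)

  ∣∁∣≡i : (S : Subset n) → ∣ S ∣ ≡ n ∸ i → ∣ ∁ S ∣ ≡ i
  ∣∁∣≡i S ∣S∣≡n∸i = trans (∣∁p∣≡n∸∣p∣ S) (trans (cong (n ∸_) ∣S∣≡n∸i) (m∸[m∸n]≡n i≤n))

  module _ {f g : Subset n → ℕ} where

    private
      from-∁ : {R : ℕ → ℕ → Set} → (∀ S → ∣ S ∣ ≡ i → R (f S) (g (∁ S))) →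
        ∀ T → ∣ T ∣ ≡ n ∸ i → R (f (∁ T)) (g T)
      from-∁ {R} rel T ∣T∣≡n∸i =
        subst (λ X → R (f (∁ T)) (g X)) (∁-involutive T) (rel (∁ T) (∣∁∣≡i T ∣T∣≡n∸i))

    maxOver-∁ : ∀ {a b} → (∀ S → ∣ S ∣ ≡ i → f S + a ≡ b + g (∁ S)) →
      maxOver f i + a ≡ b + maxOver g (n ∸ i)
    maxOver-∁ {a} {b} rel with maxOver-attained f i≤n | maxOver-attained g (m∸n≤m n i)
    ... | S , ∣S∣≡i , max≡fS | T , ∣T∣≡n∸i , max≡gT = ≤-antisym
      (begin
        maxOver f i + a          ≡⟨ cong (_+ a) max≡fS ⟩
        f S + a                  ≡⟨ rel S ∣S∣≡i ⟩
        b + g (∁ S)              ≤⟨ +-monoʳ-≤ b (≤-maxOver g (∁ S) (∣∁∣≡n∸i S ∣S∣≡i)) ⟩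
        b + maxOver g (n ∸ i)    ∎)
      (begin
        b + maxOver g (n ∸ i)    ≡⟨ cong (b +_) max≡gT ⟩
        b + g T                  ≡⟨ from-∁ {λ x y → x + a ≡ b + y} rel T ∣T∣≡n∸i ⟨
        f (∁ T) + a              ≤⟨ +-monoˡ-≤ a (≤-maxOver f (∁ T) (∣∁∣≡i T ∣T∣≡n∸i)) ⟩
        maxOver f i + a          ∎)
      where open ≤-Reasoning

    minOver-∁ : ∀ {a b} → (∀ S → ∣ S ∣ ≡ i → f S + a ≡ b + g (∁ S)) →
      minOver f i + a ≡ b + minOver g (n ∸ i)
    minOver-∁ {a} {b} rel with minOver-attained f i≤n | minOver-attained g (m∸n≤m n i)
    ... | S , ∣S∣≡i , min≡fS | T , ∣T∣≡n∸i , min≡gT = ≤-antisym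
      (begin
        minOver f i + a          ≤⟨ +-monoˡ-≤ a (minOver-≤ f (∁ T) (∣∁∣≡i T ∣T∣≡n∸i)) ⟩
        f (∁ T) + a              ≡⟨ from-∁ {λ x y → x + a ≡ b + y} rel T ∣T∣≡n∸i ⟩
        b + g T                  ≡⟨ cong (b +_) min≡gT ⟨
        b + minOver g (n ∸ i)    ∎)
      (begin
        b + minOver g (n ∸ i)    ≤⟨ +-monoʳ-≤ b (minOver-≤ g (∁ S) (∣∁∣≡n∸i S ∣S∣≡i)) ⟩
        b + g (∁ S)              ≡⟨ rel S ∣S∣≡i ⟨
        f S + a                  ≡⟨ cong (_+ a) min≡fS ⟨
        minOver f i + a          ∎)
      where open ≤-Reasoning

    maxOver+minOver-∁ : ∀ {c} → (∀ S → ∣ S ∣ ≡ i → f S + g (∁ S) ≡ c) →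
      maxOver f i + minOver g (n ∸ i) ≡ c
    maxOver+minOver-∁ {c} rel with maxOver-attained f i≤n | minOver-attained g (m∸n≤m n i)
    ... | S , ∣S∣≡i , max≡fS | T , ∣T∣≡n∸i , min≡gT = ≤-antisym
      (begin
        maxOver f i + minOver g (n ∸ i)
          ≤⟨ +-mono-≤ (≤-reflexive max≡fS) (minOver-≤ g (∁ S) (∣∁∣≡n∸i S ∣S∣≡i)) ⟩
        f S + g (∁ S)                   ≡⟨ rel S ∣S∣≡i ⟩
        c                               ∎)
      (begin
        c                               ≡⟨ from-∁ {λ x y → x + y ≡ c} rel T ∣T∣≡n∸i ⟨
        f (∁ T) + g T
          ≤⟨ +-mono-≤ (≤-maxOver f (∁ T) (∣∁∣≡i T ∣T∣≡n∸i)) (≤-reflexive (sym min≡gT)) ⟩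
        maxOver f i + minOver g (n ∸ i) ∎)
      where open ≤-Reasoning

    minOver+maxOver-∁ : ∀ {c} → (∀ S → ∣ S ∣ ≡ i → f S + g (∁ S) ≡ c) →
      minOver f i + maxOver g (n ∸ i) ≡ c
    minOver+maxOver-∁ {c} rel with minOver-attained f i≤n | maxOver-attained g (m∸n≤m n i)
    ... | S , ∣S∣≡i , min≡fS | T , ∣T∣≡n∸i , max≡gT = ≤-antisym
      (begin
        minOver f i + maxOver g (n ∸ i)
          ≤⟨ +-mono-≤ (minOver-≤ f (∁ T) (∣∁∣≡i T ∣T∣≡n∸i)) (≤-reflexive max≡gT) ⟩
        f (∁ T) + g T                   ≡⟨ from-∁ {λ x y → x + y ≡ c} rel T ∣T∣≡n∸i ⟩
        c                               ∎)
      (begin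
        c                               ≡⟨ rel S ∣S∣≡i ⟨
        f S + g (∁ S)
          ≤⟨ +-mono-≤ (≤-reflexive (sym min≡fS)) (≤-maxOver g (∁ S) (∣∁∣≡n∸i S ∣S∣≡i)) ⟩
        minOver f i + maxOver g (n ∸ i) ∎)
      where open ≤-Reasoning

-- Edge counts of a graph

∧∨-indicator : ∀ l a x y →
  𝟙 l * (𝟙 a * (𝟙 x + 𝟙 y)) ≡ 𝟙 (l ∧ a ∧ x ∧ y) + 𝟙 (l ∧ a ∧ (x ∨ y))
∧∨-indicator false a     x     y     = refl
∧∨-indicator true  false x     y     = refl
∧∨-indicator true  true  false false = refl
∧∨-indicator true  true  false true  = refl
∧∨-indicator true  true  true  false = refl
∧∨-indicator true  true  true  true  = refl

∨-not∧not-indicator : ∀ a x y → 𝟙 (a ∧ (x ∨ y)) + 𝟙 (a ∧ not x ∧ not y) ≡ 𝟙 a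
∨-not∧not-indicator false x     y     = refl
∨-not∧not-indicator true  false false = refl
∨-not∧not-indicator true  false true  = refl
∨-not∧not-indicator true  true  y     = refl

module _ {n : ℕ} (G : SimpleGraph n) where

  numEdges : ℕ
  numEdges = count (λ { (u , v) → adj G u v }) (orderedPairs n)

  ∑-weighted-degree : (w : Fin n → ℕ) →
    ∑[ u < n ] (w u * degree G u) ≡ ∑[ u < n ] ∑[ v < n ] (𝟙 (u <ᶠ v) * (𝟙 (adj G u v) * (w u + w v)))
  ∑-weighted-degree w = begin
    ∑[ u < n ] (w u * degree G u)
      ≡⟨ sum-cong-≗ (λ u → trans (cong (w u *_) (count-tabulate (adj G u) (λ v → v)))
                                 (*-distribˡ-sum (w u) (λ v → 𝟙 (adj G u v)))) ⟩
    ∑[ u < n ] ∑[ v < n ] (w u * 𝟙 (adj G u v))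
      ≡⟨ ∑∑-offDiagonal (λ u v → w u * 𝟙 (adj G u v))
                        (λ u → cong (λ b → w u * 𝟙 b) (irrefl G u) ⟨ trans ⟩ *-zeroʳ (w u)) ⟩
    ∑[ u < n ] ∑[ v < n ] (𝟙 (u <ᶠ v) * (w u * 𝟙 (adj G u v) + w v * 𝟙 (adj G v u)))
      ≡⟨ sum-cong-≗ (λ u → sum-cong-≗ (λ v → cong (𝟙 (u <ᶠ v) *_) (edge-weight u v))) ⟩
    ∑[ u < n ] ∑[ v < n ] (𝟙 (u <ᶠ v) * (𝟙 (adj G u v) * (w u + w v))) ∎
    where
    open ≡-Reasoning
    edge-weight : ∀ u v → w u * 𝟙 (adj G u v) + w v * 𝟙 (adj G v u) ≡ 𝟙 (adj G u v) * (w u + w v)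
    edge-weight u v rewrite SimpleGraph.sym G v u =
      trans (cong₂ _+_ (*-comm (w u) _) (*-comm (w v) _)) (sym (*-distribˡ-+ (𝟙 (adj G u v)) (w u) (w v)))

  ∑-degree-inside : (S : Subset n) → ∑[ u < n ] (𝟙 (u ∈ˢ S) * degree G u) ≡ eS G S + vcS G S
  ∑-degree-inside S = begin
    ∑[ u < n ] (𝟙 (u ∈ˢ S) * degree G u)
      ≡⟨ ∑-weighted-degree (λ u → 𝟙 (u ∈ˢ S)) ⟩
    ∑[ u < n ] ∑[ v < n ] (𝟙 (u <ᶠ v) * (𝟙 (adj G u v) * (𝟙 (u ∈ˢ S) + 𝟙 (v ∈ˢ S))))
      ≡⟨ sum-cong-≗ (λ u → sum-cong-≗ (λ v → ∧∨-indicator (u <ᶠ v) (adj G u v) (u ∈ˢ S) (v ∈ˢ S))) ⟩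
    ∑[ u < n ] ∑[ v < n ] (inside u v + touching u v)
      ≡⟨ sum-cong-≗ (λ u → ∑-distrib-+ (inside u) (touching u)) ⟨ trans ⟩
         ∑-distrib-+ (λ u → ∑[ v < n ] inside u v) (λ u → ∑[ v < n ] touching u v) ⟩
    ∑[ u < n ] ∑[ v < n ] inside u v + ∑[ u < n ] ∑[ v < n ] touching u v
      ≡⟨ sym (cong₂ _+_ (count-orderedPairs {n} _) (count-orderedPairs {n} _)) ⟩
    eS G S + vcS G S ∎
    where
    open ≡-Reasoning
    inside touching : Fin n → Fin n → ℕ
    inside u v = 𝟙 ((u <ᶠ v) ∧ adj G u v ∧ (u ∈ˢ S) ∧ (v ∈ˢ S))
    touching u v = 𝟙 ((u <ᶠ v) ∧ adj G u v ∧ ((u ∈ˢ S) ∨ (v ∈ˢ S)))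

  vcS+eS∁≡numEdges : (S : Subset n) → vcS G S + eS G (∁ S) ≡ numEdges
  vcS+eS∁≡numEdges S = count-+ (λ { (u , v) → edge u v }) (orderedPairs n)
    where
    edge : ∀ u v →
      𝟙 (adj G u v ∧ ((u ∈ˢ S) ∨ (v ∈ˢ S))) + 𝟙 (adj G u v ∧ (u ∈ˢ ∁ S) ∧ (v ∈ˢ ∁ S)) ≡ 𝟙 (adj G u v)
    edge u v rewrite lookup-map u not S | lookup-map v not S = ∨-not∧not-indicator (adj G u v) (u ∈ˢ S) (v ∈ˢ S)

  eS-⊤ : eS G ⊤ ≡ numEdges
  eS-⊤ = count-cong (λ { (u , v) → edge u v }) (orderedPairs n)
    where
    edge : ∀ u v → adj G u v ∧ (u ∈ˢ ⊤) ∧ (v ∈ˢ ⊤) ≡ adj G u v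
    edge u v rewrite lookup-replicate {n = n} u true | lookup-replicate {n = n} v true = ∧-identityʳ (adj G u v)

  vcS-⊤ : vcS G ⊤ ≡ numEdges
  vcS-⊤ = count-cong (λ { (u , v) → edge u v }) (orderedPairs n)
    where
    edge : ∀ u v → adj G u v ∧ ((u ∈ˢ ⊤) ∨ (v ∈ˢ ⊤)) ≡ adj G u v
    edge u v rewrite lookup-replicate {n = n} u true = ∧-identityʳ (adj G u v)

  eS-∣∣≤1 : (S : Subset n) → ∣ S ∣ ≤ 1 → eS G S ≡ 0
  eS-∣∣≤1 S ∣S∣≤1 = count-≡0 (λ { (u , v) → no-edge u v }) (orderedPairs n)
    where
    no-edge : ∀ u v → adj G u v ∧ (u ∈ˢ S) ∧ (v ∈ˢ S) ≡ false
    no-edge u v with u ∈ˢ S in u∈ | v ∈ˢ S in v∈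
    ... | false | _     = ∧-zeroʳ (adj G u v)
    ... | true  | false = ∧-zeroʳ (adj G u v)
    ... | true  | true  with ∣∣≤1⇒∈ˢ-unique S ∣S∣≤1 u∈ v∈
    ...   | refl = trans (∧-identityʳ (adj G u u)) (irrefl G u)

  vcS-⁅⁆ : (v : Fin n) → vcS G ⁅ v ⁆ ≡ degree G v
  vcS-⁅⁆ v = begin
    vcS G ⁅ v ⁆
      ≡⟨ cong (_+ vcS G ⁅ v ⁆) (eS-∣∣≤1 ⁅ v ⁆ (≤-reflexive (∣⁅x⁆∣≡1 v))) ⟨
    eS G ⁅ v ⁆ + vcS G ⁅ v ⁆
      ≡⟨ ∑-degree-inside ⁅ v ⁆ ⟨
    ∑[ u < n ] (𝟙 (u ∈ˢ ⁅ v ⁆) * degree G u)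
      ≡⟨ ∑-⁅⁆ v (degree G) ⟩
    degree G v ∎
    where open ≡-Reasoning

  handshake : ∑[ u < n ] degree G u ≡ numEdges + numEdges
  handshake = begin
    ∑[ u < n ] degree G u
      ≡⟨ sum-cong-≗ (λ u → cong (λ b → 𝟙 b * degree G u) (lookup-replicate u true) ⟨ trans ⟩ *-identityˡ _) ⟨
    ∑[ u < n ] (𝟙 (u ∈ˢ ⊤) * degree G u)
      ≡⟨ ∑-degree-inside ⊤ ⟩
    eS G ⊤ + vcS G ⊤
      ≡⟨ cong₂ _+_ eS-⊤ vcS-⊤ ⟩
    numEdges + numEdges ∎
    where open ≡-Reasoning

  regular-eS-∁ : ∀ {d} → (∀ v → degree G v ≡ d) → ∀ {i} (S : Subset n) → ∣ S ∣ ≡ i →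
    eS G S + numEdges ≡ d * i + eS G (∁ S)
  regular-eS-∁ {d} reg S refl = begin
    eS G S + numEdges
      ≡⟨ cong (eS G S +_) (vcS+eS∁≡numEdges S) ⟨
    eS G S + (vcS G S + eS G (∁ S))
      ≡⟨ +-assoc (eS G S) _ _ ⟨
    (eS G S + vcS G S) + eS G (∁ S)
      ≡⟨ cong (_+ eS G (∁ S)) (∑-degree-inside S) ⟨
    ∑[ u < n ] (𝟙 (u ∈ˢ S) * degree G u) + eS G (∁ S)
      ≡⟨ cong (_+ eS G (∁ S)) (sum-cong-≗ (λ u → cong (𝟙 (u ∈ˢ S) *_) (reg u))) ⟩
    ∑[ u < n ] (𝟙 (u ∈ˢ S) * d) + eS G (∁ S)
      ≡⟨ cong (_+ eS G (∁ S)) (*-distribʳ-sum d (λ u → 𝟙 (u ∈ˢ S))) ⟨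
    ∑[ u < n ] 𝟙 (u ∈ˢ S) * d + eS G (∁ S)
      ≡⟨ cong (λ k → k * d + eS G (∁ S)) (∑-indicator S) ⟩
    ∣ S ∣ * d + eS G (∁ S)
      ≡⟨ cong (_+ eS G (∁ S)) (*-comm ∣ S ∣ d) ⟩
    d * ∣ S ∣ + eS G (∁ S) ∎
    where open ≡-Reasoning

  T+Σ'≡numEdges : ∀ i → i ≤ n → T G i + Σ' G (n ∸ i) ≡ numEdges
  T+Σ'≡numEdges i i≤n = maxOver+minOver-∁ i≤n (λ S _ → vcS+eS∁≡numEdges S)

  Υ+Δ≡numEdges : ∀ i → i ≤ n → Υ G i + Δ G (n ∸ i) ≡ numEdges
  Υ+Δ≡numEdges i i≤n = minOver+maxOver-∁ i≤n (λ S _ → vcS+eS∁≡numEdges S)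

  Symmetric-σ⇔Symmetric-τ : Symmetric n (σ G) ⇔ Symmetric n (τ G)
  Symmetric-σ⇔Symmetric-τ = Reflected⇒Symmetric⇔ {s = τ G} {σ G} (diff-reflected {F = T G} {Σ' G} T+Σ'≡numEdges)

  Symmetric-δ⇔Symmetric-υ : Symmetric n (δ G) ⇔ Symmetric n (υ G)
  Symmetric-δ⇔Symmetric-υ = Reflected⇒Symmetric⇔ {s = υ G} {δ G} (diff-reflected {F = Υ G} {Δ G} Υ+Δ≡numEdges)

  Δ-≤1 : ∀ {i} → i ≤ 1 → i ≤ n → Δ G i ≡ 0
  Δ-≤1 i≤1 i≤n with maxOver-attained (eS G) i≤n
  ... | S , refl , Δ≡eS = trans Δ≡eS (eS-∣∣≤1 S i≤1)

  Σ'-≤1 : ∀ {i} → i ≤ 1 → i ≤ n → Σ' G i ≡ 0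
  Σ'-≤1 i≤1 i≤n with minOver-attained (eS G) i≤n
  ... | S , refl , Σ'≡eS = trans Σ'≡eS (eS-∣∣≤1 S i≤1)

  eS-∣∣≡n : (S : Subset n) → ∣ S ∣ ≡ n → eS G S ≡ numEdges
  eS-∣∣≡n S ∣S∣≡n = subst (λ X → eS G X ≡ numEdges) (sym (∣p∣≡n⇒p≡⊤ {p = S} ∣S∣≡n)) eS-⊤

  Δ-n : Δ G n ≡ numEdges
  Δ-n = let S , ∣S∣≡n , Δ≡eS = maxOver-attained (eS G) ≤-refl in trans Δ≡eS (eS-∣∣≡n S ∣S∣≡n)

  Σ'-n : Σ' G n ≡ numEdges
  Σ'-n = let S , ∣S∣≡n , Σ'≡eS = minOver-attained (eS G) ≤-refl in trans Σ'≡eS (eS-∣∣≡n S ∣S∣≡n)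

  Υ₁≤degree : ∀ v → Υ G 1 ≤ degree G v
  Υ₁≤degree v = ≤-trans (minOver-≤ (vcS G) ⁅ v ⁆ (∣⁅x⁆∣≡1 v)) (≤-reflexive (vcS-⁅⁆ v))

  degree≤T₁ : ∀ v → degree G v ≤ T G 1
  degree≤T₁ v = ≤-trans (≤-reflexive (sym (vcS-⁅⁆ v))) (≤-maxOver (vcS G) ⁅ v ⁆ (∣⁅x⁆∣≡1 v))

  Regular-of-lower-bound : ∀ {c} → (∀ v → c ≤ degree G v) → numEdges + numEdges ≡ n * c → Regular G
  Regular-of-lower-bound {c} c≤deg 2m≡n*c =
    c , λ v → sym (∑-mono-≤-≡⇒≡ c≤deg (trans (∑-const n c) (trans (sym 2m≡n*c) (sym handshake))) v)

  Regular-of-upper-bound : ∀ {c} → (∀ v → degree G v ≤ c) → numEdges + numEdges ≡ n * c → Regular G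
  Regular-of-upper-bound {c} deg≤c 2m≡n*c =
    c , ∑-mono-≤-≡⇒≡ deg≤c (trans handshake (trans 2m≡n*c (sym (∑-const n c))))

  Regular⇒Symmetric-δ : Regular G → Symmetric n (δ G)
  Regular⇒Symmetric-δ (d , reg) =
    Symmetric-of-constant-pair-sums {s = δ G} (diff-pair-sums {Δ G} {d = d} λ i i≤n →
      maxOver-∁ i≤n {eS G} {eS G} (regular-eS-∁ reg))

  Regular⇒Symmetric-σ : Regular G → Symmetric n (σ G)
  Regular⇒Symmetric-σ (d , reg) =
    Symmetric-of-constant-pair-sums {s = σ G} (diff-pair-sums {Σ' G} {d = d} λ i i≤n →
      minOver-∁ i≤n {eS G} {eS G} (regular-eS-∁ reg))

Symmetric-δ⇒Regular : ∀ {n} (G : SimpleGraph n) → Symmetric n (δ G) → Regular G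
Symmetric-δ⇒Regular {zero}  G _     = 0 , λ ()
Symmetric-δ⇒Regular {suc n} G δ-sym = Regular-of-lower-bound G (Υ₁≤degree G)
  (subst (λ m → m + m ≡ suc n * Υ G 1) (Δ-n G)
    (Symmetric-diff⇒F[n]+F[n]≡n*c {Δ G} δ-sym (Δ-≤1 G z≤n z≤n) (Δ-≤1 G ≤-refl (s≤s z≤n))
      (trans (Υ+Δ≡numEdges G 1 (s≤s z≤n)) (sym (Δ-n G)))))

Symmetric-σ⇒Regular : ∀ {n} (G : SimpleGraph n) → Symmetric n (σ G) → Regular G
Symmetric-σ⇒Regular {zero}  G _     = 0 , λ ()
Symmetric-σ⇒Regular {suc n} G σ-sym = Regular-of-upper-bound G (degree≤T₁ G)
  (subst (λ m → m + m ≡ suc n * T G 1) (Σ'-n G)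
    (Symmetric-diff⇒F[n]+F[n]≡n*c {Σ' G} σ-sym (Σ'-≤1 G z≤n z≤n) (Σ'-≤1 G ≤-refl (s≤s z≤n))
      (trans (T+Σ'≡numEdges G 1 (s≤s z≤n)) (sym (Σ'-n G)))))

Regular⇔Symmetric-δ : ∀ {n} (G : SimpleGraph n) → Regular G ⇔ Symmetric n (δ G)
Regular⇔Symmetric-δ G = mk⇔ (Regular⇒Symmetric-δ G) (Symmetric-δ⇒Regular G)

Regular⇔Symmetric-σ : ∀ {n} (G : SimpleGraph n) → Regular G ⇔ Symmetric n (σ G)
Regular⇔Symmetric-σ G = mk⇔ (Regular⇒Symmetric-σ G) (Symmetric-σ⇒Regular G)

theorem1 : ∀ (n : ℕ) (G : SimpleGraph n) → Connected G →
    (Regular G ⇔ Symmetric n (δ G)) × (Regular G ⇔ Symmetric n (σ G)) ×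
    (Regular G ⇔ Symmetric n (τ G)) × (Regular G ⇔ Symmetric n (υ G))
theorem1 n G _ =
  Regular⇔Symmetric-δ G ,
  Regular⇔Symmetric-σ G ,
  ⇔-trans (Regular⇔Symmetric-σ G) (Symmetric-σ⇔Symmetric-τ G) ,
  ⇔-trans (Regular⇔Symmetric-δ G) (Symmetric-δ⇔Symmetric-υ G)
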